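{- Let $\Gamma$ be an AGW graph without loops and with outdegree at least $2$, such that no vertex of $\Gamma$ has two incoming bunches (i.e. there are no two distinct vertices all of whose outgoing edges end at one and the same vertex). Then $\Gamma$ has a spanning subgraph in which the maximal level $L$ of a vertex is positive and all vertices of level $L$ belong to one (non-trivial) tree of this spanning subgraph.
   Context: An AGW graph is a finite directed strongly connected graph (multiple edges allowed) in which all vertices have the same outdegree $k$, and the greatest common divisor of the lengths of all its cycles is $1$. The set of all outgoing edges of a vertex is a bunch if all these edges end at a single vertex; a vertex $\mathbf p$ has two incoming bunches if there are two distinct vertices whose outgoing edge sets are both bunches ending at $\mathbf p$. A spanning subgraph $S$ of $\Gamma$ is a subgraph containing all vertices of $\Gamma$ and exactly one outgoing edge of every vertex; it consists of disjoint cycles together with trees hanging on them. A tree of $S$ is a maximal subtree of $S$ whose root lies on a cycle of $S$ and which has no common edges with the cycles of $S$. The level of a vertex $\mathbf p$ in $S$ is the length of the path from $\mathbf p$ along edges of its tree to the root of the tree (vertices on cycles of $S$ have level $0$). -}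

module Defs where

open import Data.Nat using (ℕ; zero; suc; _<_; _≤_)
open import Data.Nat.Divisibility using (_∣_)
open import Data.Empty using (⊥)
open import Data.Fin using (Fin)
open import Data.List using (List; []; _∷_; length)
open import Data.List.Relation.Unary.Unique.Propositional using (Unique)
open import Data.Product using (Σ; ∃; _×_; _,_)
open import Relation.Binary.PropositionalEquality using (_≡_; _≢_)
open import Relation.Nullary using (¬_)

-- A finite directed graph with n vertices (Fin n) in which every vertex has
-- outdegree exactly k: the outgoing edges of vertex p are indexed by Fin k,
-- and the edge (p , i) ends at δ p i.  Multiple edges are allowed.
record Graph (n k : ℕ) : Set where
  field
    δ : Fin n → Fin k → Fin n
open Graph public

module _ {n k : ℕ} (Γ : Graph n k) where

  walk : Fin n → List (Fin k) → Fin n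
  walk p []      = p
  walk p (i ∷ w) = walk (δ Γ p i) w

  visited : Fin n → List (Fin k) → List (Fin n)
  visited p []      = []
  visited p (i ∷ w) = p ∷ visited (δ Γ p i) w

  StronglyConnected : Set
  StronglyConnected = ∀ (p q : Fin n) → ∃ λ (w : List (Fin k)) → walk p w ≡ q

  record Cycle : Set where
    field
      start    : Fin n
      edges    : List (Fin k)
      nonempty : 0 < length edges
      closed   : walk start edges ≡ start
      simple   : Unique (visited start edges)
  open Cycle public

  CycleGcdOne : Set
  CycleGcdOne = ∀ (d : ℕ) → (∀ (C : Cycle) → d ∣ length (edges C)) → d ≡ 1

  -- AGW graph (outdegree k is built into Graph n k)
  AGW : Set
  AGW = StronglyConnected × CycleGcdOne

  NoLoops : Set
  NoLoops = ∀ (p : Fin n) (i : Fin k) → δ Γ p i ≢ p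

  BunchTo : Fin n → Fin n → Set
  BunchTo p r = ∀ (i : Fin k) → δ Γ p i ≡ r

  NoTwoIncomingBunches : Set
  NoTwoIncomingBunches =
    ∀ (p q r : Fin n) → p ≢ q → BunchTo p r → BunchTo q r → ⊥

  -- A spanning subgraph: a choice of exactly one outgoing edge for every vertex.
  Spanning : Set
  Spanning = Fin n → Fin k

  module _ (S : Spanning) where

    next : Fin n → Fin n
    next p = δ Γ p (S p)

    next^ : ℕ → Fin n → Fin n
    next^ zero    p = p
    next^ (suc m) p = next^ m (next p)

    OnCycle : Fin n → Set
    OnCycle p = ∃ λ (m : ℕ) → 0 < m × next^ m p ≡ p

    -- p has level j in S: the path along its tree reaches the cycle (the root)
    -- after exactly j steps and not earlier
    LevelIs : Fin n → ℕ → Set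
    LevelIs p j = OnCycle (next^ j p) × (∀ (i : ℕ) → i < j → ¬ OnCycle (next^ i p))

    root : Fin n → ℕ → Fin n
    root p j = next^ j p

module Submission where

-- A spanning subgraph S chooses one outgoing edge per vertex, so it is a function f = next Γ S
-- on the vertices; its cycles, trees, levels and roots are those of the functional graph of f.  Spanning subgraphs are compared
-- lexicographically by (maximal level, number of cyclic vertices).  Lemmas A–D show that if two
-- vertices of maximal level L > 0 have different roots r₁ ≠ r₂, redirecting one or two edges
-- gives a strictly better subgraph; `improve` chooses among them, using strong connectivity
-- and the absence of two incoming bunches.  Both measures are bounded, so improving a subgraph
-- of positive maximal level (which exists by the gcd condition and the absence of loops,
-- `positive-start`) ends with the required subgraph; `lemma7` assembles these steps.

open import Data.Empty using (⊥; ⊥-elim)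
open import Data.Fin using (Fin; toℕ; fromℕ<) renaming (zero to fzero; suc to fsuc)
open import Data.Fin.Properties
  using (pigeonhole; any?; all?; ¬∀⟶∃¬; toℕ≤pred[n])
  renaming (_≟_ to _≟ᶠ_; suc-injective to fsuc-injective)
open import Data.List using ([]; _∷_; length)
open import Data.Nat
  using (ℕ; zero; suc; _+_; _*_; _∸_; _⊔_; _≤_; _<_; _>_; _≤?_; _<?_; _≟_; z≤n; s≤s; z<s; s<s;
         NonZero; >-nonZero; ≤-pred; anyUpTo?)
open import Data.Nat.DivMod using (_%_; _/_; m%n<n; m≡m%n+[m/n]*n)
open import Data.Nat.Divisibility using (_∣_; m%n≡0⇒n∣m)
open import Data.Nat.GeneralisedArithmetic using (iterate)
open import Data.Nat.Induction using (<-rec)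
open import Data.Nat.Properties
open import Algebra.Properties.CommutativeMonoid.Sum +-0-commutativeMonoid
  using (sum-syntax; sum-cong-≗; ∑-distrib-+; sum-replicate-zero)
open import Data.Nat.Tactic.RingSolver using (solve-∀)
open import Data.Product using (∃; _×_; _,_; proj₁; proj₂)
open import Data.Sum using (_⊎_; inj₁; inj₂; [_,_]′) renaming (map to ⊎-map; map₁ to ⊎-map₁)
open import Data.Unit using (⊤; tt)
open import Function using (_∘_; id)
open import Relation.Binary using (Tri; tri<; tri≈; tri>)
open import Relation.Binary.PropositionalEquality
open import Relation.Nullary using (¬_; Dec; yes; no; ¬?; _×-dec_)
open import Relation.Nullary.Decidable using (map′; decidable-stable)
open import Relation.Unary using (Decidable; _∪_)
open import Relation.Unary.Properties using (_∪?_)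

open import Defs

least : ∀ {P : ℕ → Set} → Decidable P → ∀ {m} → P m →
        ∃ λ j → j ≤ m × P j × (∀ i → i < j → ¬ P i)
least {P} P? {m} = <-rec Goal search m
  where
  Goal : ℕ → Set
  Goal m = P m → ∃ λ j → j ≤ m × P j × (∀ i → i < j → ¬ P i)
  search : ∀ m → (∀ {i} → i < m → Goal i) → Goal m
  search m below pm with anyUpTo? P? m
  ... | no none = m , ≤-refl , pm , λ i i<m pi → none (i , i<m , pi)
  ... | yes (i , i<m , pi) with below i<m pi
  ...   | j , j≤i , pj , minimal = j , ≤-trans j≤i (<⇒≤ i<m) , pj , minimal

ascend : ∀ {X : Set} (rank : X → ℕ) (B : ℕ) → (∀ x → rank x ≤ B) → (P Q : X → Set) →
         (∀ x → P x → Q x ⊎ ∃ λ x′ → rank x < rank x′ × P x′) → ∀ x → P x → ∃ Q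
ascend {X} rank B bounded P Q step x = <-rec Goal climb (B ∸ rank x) x refl
  where
  Goal : ℕ → Set
  Goal gap = ∀ x → B ∸ rank x ≡ gap → P x → ∃ Q
  climb : ∀ gap → (∀ {gap′} → gap′ < gap → Goal gap′) → Goal gap
  climb gap higher x refl px with step x px
  ... | inj₁ qx              = x , qx
  ... | inj₂ (x′ , up , px′) = higher (∸-monoʳ-< up (bounded x′)) x′ refl px′

𝟙 : ∀ {P : Set} → Dec P → ℕ
𝟙 (yes _) = 1
𝟙 (no _)  = 0

𝟙-mono : ∀ {P Q : Set} → (P → Q) → (p : Dec P) (q : Dec Q) → 𝟙 p ≤ 𝟙 q
𝟙-mono P⇒Q (yes p) (yes _) = ≤-refl
𝟙-mono P⇒Q (yes p) (no ¬q) = ⊥-elim (¬q (P⇒Q p))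
𝟙-mono P⇒Q (no _)  q       = z≤n

𝟙-cong : ∀ {P Q : Set} → (P → Q) → (Q → P) → (p : Dec P) (q : Dec Q) → 𝟙 p ≡ 𝟙 q
𝟙-cong P⇒Q Q⇒P p q = ≤-antisym (𝟙-mono P⇒Q p q) (𝟙-mono Q⇒P q p)

𝟙-no : ∀ {P : Set} → ¬ P → (p : Dec P) → 𝟙 p ≡ 0
𝟙-no ¬p (yes p) = ⊥-elim (¬p p)
𝟙-no ¬p (no _)  = refl

𝟙-≤1 : ∀ {P : Set} (p : Dec P) → 𝟙 p ≤ 1
𝟙-≤1 (yes _) = ≤-refl
𝟙-≤1 (no _)  = z≤n

𝟙-⊎ : ∀ {P Q : Set} → (P → ¬ Q) → (p : Dec P) (q : Dec Q) (pq : Dec (P ⊎ Q)) →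
      𝟙 pq ≡ 𝟙 p + 𝟙 q
𝟙-⊎ disj (yes p) (yes q) pq       = ⊥-elim (disj p q)
𝟙-⊎ disj (yes p) (no _)  (yes _)  = refl
𝟙-⊎ disj (yes p) (no _)  (no ¬pq) = ⊥-elim (¬pq (inj₁ p))
𝟙-⊎ disj (no _)  (yes q) (yes _)  = refl
𝟙-⊎ disj (no _)  (yes q) (no ¬pq) = ⊥-elim (¬pq (inj₂ q))
𝟙-⊎ disj (no ¬p) (no ¬q) (yes (inj₁ p)) = ⊥-elim (¬p p)
𝟙-⊎ disj (no ¬p) (no ¬q) (yes (inj₂ q)) = ⊥-elim (¬q q)
𝟙-⊎ disj (no _)  (no _)  (no _)   = refl

∑-mono : ∀ {m} (f g : Fin m → ℕ) → (∀ v → f v ≤ g v) → ∑[ v < m ] f v ≤ ∑[ v < m ] g v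
∑-mono {zero}  f g f≤g = z≤n
∑-mono {suc m} f g f≤g = +-mono-≤ (f≤g fzero) (∑-mono (f ∘ fsuc) (g ∘ fsuc) (f≤g ∘ fsuc))

∑-mono-< : ∀ {m} (f g : Fin m → ℕ) → (∀ v → f v ≤ g v) → ∀ w → f w < g w →
           ∑[ v < m ] f v < ∑[ v < m ] g v
∑-mono-< {suc m} f g f≤g fzero    fw<gw = +-mono-<-≤ fw<gw (∑-mono (f ∘ fsuc) (g ∘ fsuc) (f≤g ∘ fsuc))
∑-mono-< {suc m} f g f≤g (fsuc w) fw<gw =
  +-mono-≤-< (f≤g fzero) (∑-mono-< (f ∘ fsuc) (g ∘ fsuc) (f≤g ∘ fsuc) w fw<gw)

∑-≤1 : ∀ {m} (f : Fin m → ℕ) → (∀ v → f v ≤ 1) → ∑[ v < m ] f v ≤ m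
∑-≤1 {zero}  f f≤1 = z≤n
∑-≤1 {suc m} f f≤1 = +-mono-≤ (f≤1 fzero) (∑-≤1 (f ∘ fsuc) (f≤1 ∘ fsuc))

∑-𝟙-∅ : ∀ {m} {P : Fin m → Set} (P? : Decidable P) → (∀ v → ¬ P v) →
        ∑[ v < m ] 𝟙 (P? v) ≡ 0
∑-𝟙-∅ {m} P? empty = trans (sum-cong-≗ λ v → 𝟙-no (empty v) (P? v)) (sum-replicate-zero m)

∑-δ : ∀ {m} (w : Fin m) → ∑[ v < m ] 𝟙 (w ≟ᶠ v) ≡ 1
∑-δ {suc m} fzero    = cong suc (∑-𝟙-∅ {m} (λ v → fzero ≟ᶠ fsuc v) λ v ())
∑-δ {suc m} (fsuc w) = trans (sum-cong-≗ {m} λ v → 𝟙-cong fsuc-injective (cong fsuc)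
                                                       (fsuc w ≟ᶠ fsuc v) (w ≟ᶠ v))
                             (∑-δ w)

module Counting {n : ℕ} where

  count : {P : (Fin n → Set)} → Decidable P → ℕ
  count P? = ∑[ v < n ] 𝟙 (P? v)

  count-≤ : {P : (Fin n → Set)} (P? : Decidable P) → count P? ≤ n
  count-≤ P? = ∑-≤1 _ (𝟙-≤1 ∘ P?)

  count-cong : {P Q : (Fin n → Set)} (P? : Decidable P) (Q? : Decidable Q) →
               (∀ v → P v → Q v) → (∀ v → Q v → P v) → count P? ≡ count Q?
  count-cong P? Q? P⇒Q Q⇒P = sum-cong-≗ λ v → 𝟙-cong (P⇒Q v) (Q⇒P v) (P? v) (Q? v)

  count-< : {P Q : (Fin n → Set)} (P? : Decidable P) (Q? : Decidable Q) →
            (∀ v → P v → Q v) → ∀ w → Q w → ¬ P w → count P? < count Q?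
  count-< P? Q? P⇒Q w qw ¬pw = ∑-mono-< _ _ (λ v → 𝟙-mono (P⇒Q v) (P? v) (Q? v)) w (lemma (P? w) (Q? w))
    where
    lemma : (p : Dec _) (q : Dec _) → 𝟙 p < 𝟙 q
    lemma (yes pw) q        = ⊥-elim (¬pw pw)
    lemma (no _)   (yes _)  = ≤-refl
    lemma (no _)   (no ¬qw) = ⊥-elim (¬qw qw)

  count-∪ : {P Q : (Fin n → Set)} (P? : Decidable P) (Q? : Decidable Q) →
            (∀ v → P v → ¬ Q v) → count (P? ∪? Q?) ≡ count P? + count Q?
  count-∪ P? Q? disj = begin
    ∑[ v < n ] 𝟙 ((P? ∪? Q?) v)
      ≡⟨ sum-cong-≗ (λ v → 𝟙-⊎ (disj v) (P? v) (Q? v) ((P? ∪? Q?) v)) ⟩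
    ∑[ v < n ] (𝟙 (P? v) + 𝟙 (Q? v))    ≡⟨ ∑-distrib-+ (𝟙 ∘ P?) (𝟙 ∘ Q?) ⟩
    count P? + count Q?                  ∎
    where open ≡-Reasoning

  Image : (ℕ → Fin n) → ℕ → (Fin n → Set)
  Image g t v = ∃ λ u → u < t × g u ≡ v

  image? : (g : ℕ → Fin n) (t : ℕ) → Decidable (Image g t)
  image? g t v = anyUpTo? (λ u → g u ≟ᶠ v) t

  count-image : (g : ℕ → Fin n) (t : ℕ) →
                (∀ u u′ → u < t → u′ < t → g u ≡ g u′ → u ≡ u′) → count (image? g t) ≡ t
  count-image g zero    inj = ∑-𝟙-∅ (image? g 0) λ v ()
  count-image g (suc t) inj = begin
    count (image? g (suc t))                ≡⟨ count-cong _ (image? g t ∪? (g t ≟ᶠ_)) split merge ⟩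
    count (image? g t ∪? (g t ≟ᶠ_))         ≡⟨ count-∪ (image? g t) (g t ≟ᶠ_) disjoint ⟩
    count (image? g t) + count (g t ≟ᶠ_)    ≡⟨ cong₂ _+_ (count-image g t inj′) (∑-δ (g t)) ⟩
    t + 1                                   ≡⟨ +-comm t 1 ⟩
    suc t                                   ∎
    where
    open ≡-Reasoning
    inj′ : ∀ u u′ → u < t → u′ < t → g u ≡ g u′ → u ≡ u′
    inj′ u u′ u<t u′<t = inj u u′ (m≤n⇒m≤1+n u<t) (m≤n⇒m≤1+n u′<t)
    split : ∀ v → Image g (suc t) v → (Image g t ∪ (g t ≡_)) v
    split v (u , u<1+t , refl) with m≤n⇒m<n∨m≡n (≤-pred u<1+t)
    ... | inj₁ u<t  = inj₁ (u , u<t , refl)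
    ... | inj₂ refl = inj₂ refl
    merge : ∀ v → (Image g t ∪ (g t ≡_)) v → Image g (suc t) v
    merge v (inj₁ (u , u<t , gu≡v)) = u , m≤n⇒m≤1+n u<t , gu≡v
    merge v (inj₂ gt≡v)             = t , ≤-refl , gt≡v
    disjoint : ∀ v → Image g t v → ¬ g t ≡ v
    disjoint v (u , u<t , gu≡v) gt≡v =
      <⇒≢ u<t (inj u t (m≤n⇒m≤1+n u<t) ≤-refl (trans gu≡v (sym gt≡v)))

maxOver : ∀ {m} → (Fin m → ℕ) → ℕ
maxOver {zero}  h = 0
maxOver {suc m} h = h fzero ⊔ maxOver (h ∘ fsuc)

≤-maxOver : ∀ {m} (h : Fin m → ℕ) v → h v ≤ maxOver h
≤-maxOver h fzero    = m≤m⊔n (h fzero) _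
≤-maxOver h (fsuc v) = ≤-trans (≤-maxOver (h ∘ fsuc) v) (m≤n⊔m (h fzero) _)

maxOver-≤ : ∀ {m} (h : Fin m → ℕ) b → (∀ v → h v ≤ b) → maxOver h ≤ b
maxOver-≤ {zero}  h b h≤b = z≤n
maxOver-≤ {suc m} h b h≤b = ⊔-lub (h≤b fzero) (maxOver-≤ (h ∘ fsuc) b (h≤b ∘ fsuc))

maxOver-attained : ∀ {m} (h : Fin m → ℕ) → 0 < maxOver h → ∃ λ v → h v ≡ maxOver h
maxOver-attained {suc m} h pos with ≤-total (h fzero) (maxOver (h ∘ fsuc))
... | inj₂ ge = fzero , sym (m≥n⇒m⊔n≡m ge)
... | inj₁ le with maxOver-attained (h ∘ fsuc) (<-≤-trans pos (≤-reflexive (m≤n⇒m⊔n≡n le)))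
...   | v , hv≡max = fsuc v , trans hv≡max (sym (m≤n⇒m⊔n≡n le))

-- The arithmetic behind shortcutting a walk: a + (T ∸ b) < T when a < b ≤ T.
catch-up-< : ∀ {a b T} → a < b → b ≤ T → a + (T ∸ b) < T
catch-up-< {a} {b} {T} a<b b≤T = begin-strict
  a + (T ∸ b)  <⟨ +-monoˡ-< (T ∸ b) a<b ⟩
  b + (T ∸ b)  ≡⟨ m+[n∸m]≡n b≤T ⟩
  T            ∎
  where open ≤-Reasoning

_^_ : {A : Set} → (A → A) → ℕ → A → A
(f ^ m) v = iterate f v m

module _ {A : Set} (f : A → A) where

  ^-+ : ∀ a b v → (f ^ (a + b)) v ≡ (f ^ b) ((f ^ a) v)
  ^-+ zero    b v = refl
  ^-+ (suc a) b v = ^-+ a b (f v)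

  ^-suc : ∀ m v → (f ^ suc m) v ≡ f ((f ^ m) v)
  ^-suc zero    v = refl
  ^-suc (suc m) v = ^-suc m (f v)

  ^-comm : ∀ a b v → (f ^ a) ((f ^ b) v) ≡ (f ^ b) ((f ^ a) v)
  ^-comm a b v = trans (sym (^-+ b a v)) (trans (cong (λ m → (f ^ m) v) (+-comm b a)) (^-+ a b v))

  ^-split : ∀ {a b} v → a ≤ b → (f ^ b) v ≡ (f ^ (b ∸ a)) ((f ^ a) v)
  ^-split {a} {b} v a≤b = trans (cong (λ m → (f ^ m) v) (sym (m+[n∸m]≡n a≤b))) (^-+ a (b ∸ a) v)

  ^-periodic : ∀ {c} v → (f ^ c) v ≡ v → ∀ j → (f ^ (j * c)) v ≡ v
  ^-periodic v fix zero    = refl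
  ^-periodic {c} v fix (suc j) = trans (^-+ c (j * c) v) (trans (cong (f ^ (j * c)) fix) (^-periodic v fix j))

  ^-mod : ∀ {c} v .{{_ : NonZero c}} → (f ^ c) v ≡ v → ∀ m → (f ^ m) v ≡ (f ^ (m % c)) v
  ^-mod {c} v fix m = begin
    (f ^ m) v
      ≡⟨ cong (λ k → (f ^ k) v) (trans (m≡m%n+[m/n]*n m c) (+-comm (m % c) (m / c * c))) ⟩
    (f ^ (m / c * c + m % c)) v           ≡⟨ ^-+ (m / c * c) (m % c) v ⟩
    (f ^ (m % c)) ((f ^ (m / c * c)) v)   ≡⟨ cong (f ^ (m % c)) (^-periodic v fix (m / c)) ⟩
    (f ^ (m % c)) v                       ∎
    where open ≡-Reasoning

  minimal-period-divides : ∀ {v c} → (f ^ suc c) v ≡ v → (∀ i → i < c → (f ^ suc i) v ≢ v) →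
                           ∀ m → (f ^ m) v ≡ v → suc c ∣ m
  minimal-period-divides {v} {c} fix minimal m m-fix = m%n≡0⇒n∣m m (suc c) (remainder-0 (m % suc c) refl)
    where
    remainder-0 : ∀ r → m % suc c ≡ r → r ≡ 0
    remainder-0 zero    _  = refl
    remainder-0 (suc r) eq = ⊥-elim (minimal r (≤-pred (subst (_< suc c) eq (m%n<n m (suc c))))
                               (trans (cong (λ k → (f ^ k) v) (sym eq)) (trans (sym (^-mod v fix m)) m-fix)))

  Reach : A → A → Set
  Reach v w = ∃ λ m → (f ^ m) v ≡ w

  reach-trans : ∀ {u v w} → Reach u v → Reach v w → Reach u w
  reach-trans {u} (a , refl) (b , refl) = a + b , ^-+ a b u

  Cyclic : A → Set
  Cyclic v = ∃ λ m → 0 < m × (f ^ m) v ≡ v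

  cyclic-f : ∀ {v} → Cyclic v → Cyclic (f v)
  cyclic-f {v} (m , 0<m , fix) = m , 0<m , trans (^-suc m v) (cong f fix)

  cyclic-^ : ∀ m {v} → Cyclic v → Cyclic ((f ^ m) v)
  cyclic-^ zero    c = c
  cyclic-^ (suc m) c = cyclic-^ m (cyclic-f c)

  cyclic-reach : ∀ {v w} → Cyclic v → Reach v w → Cyclic w
  cyclic-reach c (m , refl) = cyclic-^ m c

  cyclic-return : ∀ {v w} → Cyclic v → Reach v w → Reach w v
  cyclic-return {v} (c , 0<c , fix) (m , refl) = m * c ∸ m , (begin
    (f ^ (m * c ∸ m)) ((f ^ m) v)   ≡⟨ sym (^-split v m≤m*c) ⟩
    (f ^ (m * c)) v                 ≡⟨ ^-periodic v fix m ⟩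
    v                               ∎)
    where
    open ≡-Reasoning
    m≤m*c : m ≤ m * c
    m≤m*c = m≤m*n m c {{>-nonZero 0<c}}

  Level : A → ℕ → Set
  Level v j = Cyclic ((f ^ j) v) × (∀ i → i < j → ¬ Cyclic ((f ^ i) v))

  repeat⇒cyclic : ∀ {a b} v → a < b → (f ^ a) v ≡ (f ^ b) v → Cyclic ((f ^ a) v)
  repeat⇒cyclic {a} {b} v a<b same = b ∸ a , m<n⇒0<n∸m a<b , trans (sym (^-split v (<⇒≤ a<b))) (sym same)

  level-path-injective : ∀ {v L u u′} → Level v L → u < L → u′ < L →
                         (f ^ u) v ≡ (f ^ u′) v → u ≡ u′
  level-path-injective {v} {L} {u} {u′} (_ , acyclic) u<L u′<L same with <-cmp u u′
  ... | tri< u<u′ _ _ = ⊥-elim (acyclic u u<L (repeat⇒cyclic v u<u′ same))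
  ... | tri≈ _ u≡u′ _ = u≡u′
  ... | tri> _ _ u′<u = ⊥-elim (acyclic u′ u′<L (repeat⇒cyclic v u′<u (sym same)))

  catch-up : ∀ a v {b w} T → (f ^ a) v ≡ (f ^ b) w → b ≤ T → (f ^ (a + (T ∸ b))) v ≡ (f ^ T) w
  catch-up a v {b} {w} T meet b≤T = begin
    (f ^ (a + (T ∸ b))) v      ≡⟨ ^-+ a (T ∸ b) v ⟩
    (f ^ (T ∸ b)) ((f ^ a) v)  ≡⟨ cong (f ^ (T ∸ b)) meet ⟩
    (f ^ (T ∸ b)) ((f ^ b) w)  ≡⟨ sym (^-split w b≤T) ⟩
    (f ^ T) w                  ∎
    where open ≡-Reasoning

  paths-meet : ∀ {v w L i j} → Level v L → Level w L → i < L → j < L →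
               (f ^ i) v ≡ (f ^ j) w → (f ^ L) v ≡ (f ^ L) w
  paths-meet {v} {w} {L} {i} {j} (root-v , acyclic-v) (root-w , acyclic-w) i<L j<L meet with <-cmp i j
  ... | tri< i<j _ _ = ⊥-elim (acyclic-v (i + (L ∸ j)) (catch-up-< i<j (<⇒≤ j<L))
                         (subst Cyclic (sym (catch-up i v L meet (<⇒≤ j<L))) root-w))
  ... | tri> _ _ j<i = ⊥-elim (acyclic-w (j + (L ∸ i)) (catch-up-< j<i (<⇒≤ i<L))
                         (subst Cyclic (sym (catch-up j w L (sym meet) (<⇒≤ i<L))) root-v))
  ... | tri≈ _ refl _ = trans (cong (λ m → (f ^ m) v) (sym (m+[n∸m]≡n (<⇒≤ i<L))))
                              (catch-up i v L meet (<⇒≤ j<L))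

  first-hit-injective : ∀ {v w t u u′} → (f ^ t) v ≡ w → (∀ i → i < t → (f ^ i) v ≢ w) →
                        u < t → u′ < t → (f ^ u) v ≡ (f ^ u′) v → u ≡ u′
  first-hit-injective {v} {w} {t} {u} {u′} hit before u<t u′<t same with <-cmp u u′
  ... | tri< u<u′ _ _ = ⊥-elim (before (u + (t ∸ u′)) (catch-up-< u<u′ (<⇒≤ u′<t))
                                  (trans (catch-up u v t same (<⇒≤ u′<t)) hit))
  ... | tri≈ _ u≡u′ _ = u≡u′
  ... | tri> _ _ u′<u = ⊥-elim (before (u′ + (t ∸ u)) (catch-up-< u′<u (<⇒≤ u<t))
                                  (trans (catch-up u′ v t (sym same) (<⇒≤ u<t)) hit))

  -- A walk from r that reaches v for the first time does not pass through a predecessor of r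
  -- (else it would return to r and could reach v sooner).
  first-hit-avoids-pred : ∀ {a r v x} → f a ≡ r → (f ^ x) r ≡ v →
                          (∀ i → i < x → (f ^ i) r ≢ v) → ∀ i → i < x → (f ^ i) r ≢ a
  first-hit-avoids-pred {a} {r} {v} {x} fa≡r hit before i i<x at-a =
    before (0 + (x ∸ suc i)) (catch-up-< z<s i<x) (trans (catch-up 0 r x back i<x) hit)
    where
    back : (f ^ 0) r ≡ (f ^ suc i) r
    back = sym (trans (^-suc i r) (trans (cong f at-a) fa≡r))

  arcs-disjoint : ∀ {r y s t x u} → (f ^ s) r ≡ y → (∀ j → j < s → (f ^ j) r ≢ y) →
                  (f ^ t) (f y) ≡ r → (∀ j → j < t → (f ^ j) (f y) ≢ r) →
                  x ≤ s → u < t → (f ^ x) r ≢ (f ^ u) (f y)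
  arcs-disjoint {r} {y} {s} {t} {x} {u} s-hit s-before t-hit t-before x≤s u<t meet with x + (t ∸ u) ≤? s
  ... | yes c≤s = s-before (s ∸ c) (∸-monoʳ-< {s} {c} {0} 0<c c≤s) (begin
      (f ^ (s ∸ c)) r               ≡⟨ cong (f ^ (s ∸ c)) (sym r-return) ⟩
      (f ^ (s ∸ c)) ((f ^ c) r)     ≡⟨ sym (^-split r c≤s) ⟩
      (f ^ s) r                     ≡⟨ s-hit ⟩
      y                             ∎)
    where
    open ≡-Reasoning
    c : ℕ
    c = x + (t ∸ u)
    0<c : 0 < c
    0<c = <-≤-trans (m<n⇒0<n∸m u<t) (m≤n+m (t ∸ u) x)
    r-return : (f ^ c) r ≡ r
    r-return = trans (catch-up x r t meet (<⇒≤ u<t)) t-hit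
  ... | no c≰s = first-hit-avoids-pred refl t-hit t-before (u + (s ∸ x)) shortcut
                   (trans (catch-up u (f y) s (sym meet) x≤s) s-hit)
    where
    shortcut : u + (s ∸ x) < t
    shortcut = begin-strict
      u + (s ∸ x)  <⟨ +-monoʳ-< u (+-cancelˡ-< x (s ∸ x) (t ∸ u)
                        (subst (_< x + (t ∸ u)) (sym (m+[n∸m]≡n x≤s)) (≰⇒> c≰s))) ⟩
      u + (t ∸ u)  ≡⟨ m+[n∸m]≡n (<⇒≤ u<t) ⟩
      t            ∎
      where open ≤-Reasoning

  cyclic-pred : ∀ {r} → Cyclic r → ∃ λ a → Cyclic a × f a ≡ r
  cyclic-pred {r} c@(suc m , _ , fix) = (f ^ m) r , cyclic-^ m c , trans (sym (^-suc m r)) fix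

  cyclic-injective : ∀ {u w} → Cyclic u → Cyclic w → f u ≡ f w → u ≡ w
  cyclic-injective {u} {w} (suc c₁ , _ , fix₁) (suc c₂ , _ , fix₂) fu≡fw = begin
    u                                    ≡⟨ sym fix₁ ⟩
    (f ^ c₁) z                           ≡⟨ cong (f ^ c₁) (sym (^-periodic z z-period₁ c₂)) ⟩
    (f ^ c₁) ((f ^ (c₂ * suc c₁)) z)     ≡⟨ sym (^-+ (c₂ * suc c₁) c₁ z) ⟩
    (f ^ (c₂ * suc c₁ + c₁)) z           ≡⟨ cong (λ m → (f ^ m) z) (exchange c₁ c₂) ⟩
    (f ^ (c₁ * suc c₂ + c₂)) z           ≡⟨ ^-+ (c₁ * suc c₂) c₂ z ⟩
    (f ^ c₂) ((f ^ (c₁ * suc c₂)) z)     ≡⟨ cong (f ^ c₂) (^-periodic z z-period₂ c₁) ⟩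
    (f ^ c₂) z                           ≡⟨ cong (f ^ c₂) fu≡fw ⟩
    (f ^ c₂) (f w)                       ≡⟨ fix₂ ⟩
    w                                    ∎
    where
    open ≡-Reasoning
    z : A
    z = f u
    exchange : ∀ a b → b * suc a + a ≡ a * suc b + b
    exchange = solve-∀
    z-period₁ : (f ^ suc c₁) z ≡ z
    z-period₁ = trans (^-suc c₁ z) (cong f fix₁)
    z-period₂ : (f ^ suc c₂) z ≡ z
    z-period₂ = trans (cong (f ^ suc c₂) fu≡fw) (trans (^-suc c₂ (f w)) (trans (cong f fix₂) (sym fu≡fw)))

module _ {n : ℕ} (f : Fin n → Fin n) where

  -- After n steps every walk has entered a cycle (pigeonhole on its first n + 1 vertices).
  cyclic-^n : ∀ v → Cyclic f ((f ^ n) v)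
  cyclic-^n v with pigeonhole (n<1+n n) (λ i → (f ^ toℕ i) v)
  ... | i , j , i<j , same = subst (Cyclic f) (sym (^-split f v a≤n)) (cyclic-^ f (n ∸ a) u-cyclic)
    where
    a : ℕ
    a = toℕ i
    a≤n : a ≤ n
    a≤n = ≤-trans (<⇒≤ i<j) (toℕ≤pred[n] j)
    u-cyclic : Cyclic f ((f ^ a) v)
    u-cyclic = repeat⇒cyclic f v i<j same

  cyclic⇒^n : ∀ {v} → Cyclic f v → ∃ λ u → (f ^ n) u ≡ v
  cyclic⇒^n {v} c with cyclic-return f c (n , refl)
  ... | m , back = (f ^ m) v , trans (^-comm f n m v) back

  cyclic? : Decidable (Cyclic f)
  cyclic? v = map′ (λ (u , e) → subst (Cyclic f) e (cyclic-^n u)) cyclic⇒^n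
                   (any? λ u → (f ^ n) u ≟ᶠ v)

  -- From a cyclic vertex reachability is decidable: steps count modulo the period.
  reach? : ∀ {v} → Cyclic f v → ∀ w → Dec (Reach f v w)
  reach? {v} (c , 0<c , fix) w =
    map′ (λ (m , _ , e) → m , e) reduce (anyUpTo? (λ m → (f ^ m) v ≟ᶠ w) c)
    where
    instance
      c≢0 : NonZero c
      c≢0 = >-nonZero 0<c
    reduce : Reach f v w → ∃ λ m → m < c × (f ^ m) v ≡ w
    reduce (m , refl) = m % c , m%n<n m c , sym (^-mod f v fix m)

  first-hit : ∀ {v w} → Reach f v w → ∃ λ m → (f ^ m) v ≡ w × (∀ i → i < m → (f ^ i) v ≢ w)
  first-hit {v} {w} (m , hit) with least (λ i → (f ^ i) v ≟ᶠ w) {m} hit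
  ... | j , _ , first , before = j , first , before

  abstract
    level : ∀ v → ∃ λ j → j ≤ n × Level f v j
    level v with least (λ j → cyclic? ((f ^ j) v)) {n} (cyclic-^n v)
    ... | j , j≤n , root , before = j , j≤n , root , before

  lev : Fin n → ℕ
  lev v = proj₁ (level v)

  lev-≤ : ∀ v → lev v ≤ n
  lev-≤ v = proj₁ (proj₂ (level v))

  lev-level : ∀ v → Level f v (lev v)
  lev-level v = proj₂ (proj₂ (level v))

  level-unique : ∀ {v j} → Level f v j → j ≡ lev v
  level-unique {v} {j} (root , before) with <-cmp j (lev v)
  ... | tri< j<l _ _ = ⊥-elim (proj₂ (lev-level v) j j<l root)
  ... | tri≈ _ j≡l _ = j≡l
  ... | tri> _ _ l<j = ⊥-elim (before (lev v) l<j (proj₁ (lev-level v)))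

  level-squeezed : ∀ {v ℓ} → ℓ < lev v → lev v ≤ suc ℓ → Level f v (suc ℓ)
  level-squeezed {v} ℓ<l l≤L = subst (Level f v) (≤-antisym l≤L ℓ<l) (lev-level v)

  lev-> : ∀ {v} M → ¬ Cyclic f ((f ^ M) v) → M < lev v
  lev-> {v} M acyclic with lev v ≤? M
  ... | no l≰M = ≰⇒> l≰M
  ... | yes l≤M = ⊥-elim (acyclic (subst (Cyclic f) (sym (^-split f v l≤M))
                                        (cyclic-^ f (M ∸ lev v) (proj₁ (lev-level v)))))

  abstract
    maxLevel : ℕ
    maxLevel = maxOver lev

    lev-≤-maxLevel : ∀ v → lev v ≤ maxLevel
    lev-≤-maxLevel = ≤-maxOver lev

    maxLevel-≤ : maxLevel ≤ n
    maxLevel-≤ = maxOver-≤ lev n lev-≤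

    maxLevel-attained : 0 < maxLevel → ∃ λ v → lev v ≡ maxLevel
    maxLevel-attained = maxOver-attained lev

    cycleCount : ℕ
    cycleCount = Counting.count cyclic?

    cycleCount-count : cycleCount ≡ Counting.count cyclic?
    cycleCount-count = refl

module _ {n : ℕ} (f : Fin n → Fin n) where

  OneRoot : ℕ → Set
  OneRoot L = ∀ p q → Level f p L → Level f q L → (f ^ L) p ≡ (f ^ L) q

  one-root-or-two : ∀ L → OneRoot L ⊎
                    ∃ λ p → ∃ λ q → Level f p L × Level f q L × (f ^ L) p ≢ (f ^ L) q
  one-root-or-two L with any? (λ p → any? (λ q → conflict? p q))
    where
    conflict? : ∀ p q → Dec (lev f p ≡ L × lev f q ≡ L × ¬ (f ^ L) p ≡ (f ^ L) q)
    conflict? p q = (lev f p ≟ L) ×-dec (lev f q ≟ L) ×-dec ¬? ((f ^ L) p ≟ᶠ (f ^ L) q)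
  ... | yes (p , q , lev-p , lev-q , split) = inj₂ (p , q , at-level lev-p , at-level lev-q , split)
    where
    at-level : ∀ {v} → lev f v ≡ L → Level f v L
    at-level {v} eq = subst (Level f v) eq (lev-level f v)
  ... | no none = inj₁ λ p q level-p level-q → decidable-stable ((f ^ L) p ≟ᶠ (f ^ L) q)
                    λ split → none (p , q , sym (level-unique f level-p) , sym (level-unique f level-q) , split)

-- g arises from f by redirecting the arrow leaving x: they agree everywhere else.
AgreeOff : {A : Set} → (A → A) → (A → A) → A → Set
AgreeOff f g x = ∀ u → u ≢ x → g u ≡ f u

agree-sym : ∀ {A : Set} {f g : A → A} {x} → AgreeOff f g x → AgreeOff g f x
agree-sym agree u u≢x = sym (agree u u≢x)

module _ {A : Set} {f g : A → A} {x : A} (agree : AgreeOff f g x) where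

  agree-^ : ∀ m v → (∀ i → i < m → (f ^ i) v ≢ x) → (g ^ m) v ≡ (f ^ m) v
  agree-^ zero    v avoid = refl
  agree-^ (suc m) v avoid =
    trans (cong (g ^ m) (agree v (avoid 0 z<s))) (agree-^ m (f v) (λ i i<m → avoid (suc i) (s<s i<m)))

  unreached-^ : ∀ {v} → ¬ Reach f v x → ∀ m → (g ^ m) v ≡ (f ^ m) v
  unreached-^ {v} unreached m = agree-^ m v (λ i _ hit → unreached (i , hit))

  unreached-reach : ∀ {v} → ¬ Reach f v x → ¬ Reach g v x
  unreached-reach unreached (m , hit) = unreached (m , trans (sym (unreached-^ unreached m)) hit)

  unreached-cyclic : ∀ {v} → ¬ Reach f v x → Cyclic f v → Cyclic g v
  unreached-cyclic unreached (m , 0<m , fix) = m , 0<m , trans (unreached-^ unreached m) fix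

unreached-acyclic : ∀ {A : Set} {f g : A → A} {x v} → AgreeOff f g x → ¬ Reach f v x →
                    ∀ M → ¬ Cyclic f ((f ^ M) v) → ¬ Cyclic g ((g ^ M) v)
unreached-acyclic {f = f} {g} {x} {v} agree unreached M acyclic cyclic =
  acyclic (unreached-cyclic (agree-sym agree) (unreached-reach agree unreached′)
                            (subst (Cyclic g) (unreached-^ agree unreached M) cyclic))
  where
  unreached′ : ¬ Reach f ((f ^ M) v) x
  unreached′ r = unreached (reach-trans f (M , refl) r)

-- Redirecting one arrow of a permutation (every vertex cyclic) to a new target leaves a vertex
-- off the cycles: the old predecessor of the new target and x would share their image.
redirect-permutation : ∀ {A : Set} {f g : A → A} {x} → AgreeOff f g x → (∀ v → Cyclic f v) →
                       g x ≢ f x → ¬ (∀ v → Cyclic g v)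
redirect-permutation {f = f} {g} {x} agree all-f gx≢fx all-g with cyclic-pred f (all-f (g x))
... | c , _ , f-c = c≢x (cyclic-injective g (all-g c) (all-g x) (trans (agree c c≢x) f-c))
  where
  c≢x : c ≢ x
  c≢x refl = gx≢fx (sym f-c)

module _ {n : ℕ} where

  Better : (f g : Fin n → Fin n) → Set
  Better f g = maxLevel f < maxLevel g ⊎ (maxLevel g ≡ maxLevel f × cycleCount f < cycleCount g)

  better-by-level : ∀ {f g : Fin n → Fin n} {L} v → maxLevel f ≡ L → L < lev g v → Better f g
  better-by-level {g = g} v refl lt = inj₁ (≤-trans lt (lev-≤-maxLevel g v))

  better-by-cycles : ∀ {f g : Fin n → Fin n} {L} v → maxLevel f ≡ L → L ≤ lev g v →
                     cycleCount f < cycleCount g → Better f g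
  better-by-cycles {f} {g} v refl le more with m≤n⇒m<n∨m≡n (≤-trans le (lev-≤-maxLevel g v))
  ... | inj₁ lt  = inj₁ lt
  ... | inj₂ eq = inj₂ (sym eq , more)

  more-cycles : ∀ {f g : Fin n → Fin n} {w} → (∀ v → Cyclic f v → Cyclic g v) →
                Cyclic g w → ¬ Cyclic f w → cycleCount f < cycleCount g
  more-cycles {f} {g} kept gained new = subst₂ _<_ (sym (cycleCount-count f)) (sym (cycleCount-count g))
                                          (Counting.count-< (cyclic? f) (cyclic? g) kept _ gained new)

  cycleCount-≤ : ∀ f → cycleCount f ≤ n
  cycleCount-≤ f = subst (_≤ n) (sym (cycleCount-count f)) (Counting.count-≤ (cyclic? f))

  better-via-tie : ∀ {f g h : Fin n → Fin n} → maxLevel g ≡ maxLevel f → cycleCount g ≡ cycleCount f →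
                   Better g h → Better f h
  better-via-tie max≡ count≡ (inj₁ lt) = inj₁ (subst (_< _) max≡ lt)
  better-via-tie max≡ count≡ (inj₂ (eq , lt)) = inj₂ (trans eq max≡ , subst (_< _) count≡ lt)

  better⇒maxLevel-≤ : ∀ {f g : Fin n → Fin n} → Better f g → maxLevel f ≤ maxLevel g
  better⇒maxLevel-≤ (inj₁ lt)       = <⇒≤ lt
  better⇒maxLevel-≤ (inj₂ (eq , _)) = ≤-reflexive (sym eq)

  -- Both measures are bounded by n, so improvement cannot go on forever.
  rank : (Fin n → Fin n) → ℕ
  rank f = maxLevel f * suc n + cycleCount f

  rank-≤ : ∀ f → rank f ≤ n * suc n + n
  rank-≤ f = +-mono-≤ (*-monoˡ-≤ (suc n) (maxLevel-≤ f)) (cycleCount-≤ f)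

  better⇒rank-< : ∀ {f g : Fin n → Fin n} → Better f g → rank f < rank g
  better⇒rank-< {f} {g} (inj₁ lt) = begin-strict
    maxLevel f * suc n + cycleCount f  <⟨ +-monoʳ-< (maxLevel f * suc n) (s≤s (cycleCount-≤ f)) ⟩
    maxLevel f * suc n + suc n         ≡⟨ +-comm (maxLevel f * suc n) (suc n) ⟩
    suc (maxLevel f) * suc n           ≤⟨ *-monoˡ-≤ (suc n) lt ⟩
    maxLevel g * suc n                 ≤⟨ m≤m+n _ _ ⟩
    rank g                             ∎
    where open ≤-Reasoning
  better⇒rank-< {f} {g} (inj₂ (eq , lt)) =
    subst (λ m → rank f < m * suc n + cycleCount g) (sym eq) (+-monoʳ-< (maxLevel f * suc n) lt)

module _ {n k : ℕ} (Γ : Graph n k) where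

  redirect : Spanning Γ → Fin n → Fin k → Spanning Γ
  redirect S x j v with v ≟ᶠ x
  ... | yes _ = j
  ... | no  _ = S v

  redirect-at : ∀ S x j → next Γ (redirect S x j) x ≡ δ Γ x j
  redirect-at S x j with x ≟ᶠ x
  ... | yes _   = refl
  ... | no  x≢x = ⊥-elim (x≢x refl)

  redirect-agree : ∀ S x j → AgreeOff (next Γ S) (next Γ (redirect S x j)) x
  redirect-agree S x j v v≢x with v ≟ᶠ x
  ... | yes v≡x = ⊥-elim (v≢x v≡x)
  ... | no  _   = refl

module TwoRoots {n k : ℕ} (Γ : Graph n k) (S : Spanning Γ) (ℓ : ℕ) {p₁ p₂ : Fin n}
  (max : maxLevel (next Γ S) ≡ suc ℓ)
  (level₁ : Level (next Γ S) p₁ (suc ℓ)) (level₂ : Level (next Γ S) p₂ (suc ℓ))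
  (distinct : (next Γ S ^ suc ℓ) p₁ ≢ (next Γ S ^ suc ℓ) p₂) where

  f : Fin n → Fin n
  f = next Γ S

  L : ℕ
  L = suc ℓ

  r₁ r₂ : Fin n
  r₁ = (f ^ L) p₁
  r₂ = (f ^ L) p₂

  r₁-cyclic : Cyclic f r₁
  r₁-cyclic = proj₁ level₁

  r₂-cyclic : Cyclic f r₂
  r₂-cyclic = proj₁ level₂

  path₁-acyclic : ∀ i → i < L → ¬ Cyclic f ((f ^ i) p₁)
  path₁-acyclic = proj₂ level₁

  path₂-acyclic : ∀ i → i < L → ¬ Cyclic f ((f ^ i) p₂)
  path₂-acyclic = proj₂ level₂

  q₂ : Fin n
  q₂ = (f ^ ℓ) p₂

  f-q₂ : f q₂ ≡ r₂
  f-q₂ = sym (^-suc f ℓ p₂)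

  acyclic-≢ : ∀ {u v} → ¬ Cyclic f u → Cyclic f v → u ≢ v
  acyclic-≢ acyclic cyclic refl = acyclic cyclic

  module _ {g : Fin n → Fin n} {x : Fin n} (agree : AgreeOff f g x) (x-cyclic : Cyclic f x) where

    path₁-kept : ∀ m → m ≤ L → (g ^ m) p₁ ≡ (f ^ m) p₁
    path₁-kept m m≤L =
      agree-^ agree m p₁ λ i i<m → acyclic-≢ (path₁-acyclic i (<-≤-trans i<m m≤L)) x-cyclic

    path₂-kept : ∀ m → m ≤ L → (g ^ m) p₂ ≡ (f ^ m) p₂
    path₂-kept m m≤L =
      agree-^ agree m p₂ λ i i<m → acyclic-≢ (path₂-acyclic i (<-≤-trans i<m m≤L)) x-cyclic

    -- If the redirection keeps every cycle and x is not the cycle predecessor of r₂, then q₂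
    -- stays off the cycles of g (the predecessor of r₂ is still cyclic), so p₂ keeps level ≥ L.
    p₂-stays-deep : (∀ v → Cyclic f v → Cyclic g v) → f x ≢ r₂ → L ≤ lev g p₂
    p₂-stays-deep kept fx≢r₂ =
      lev-> g ℓ λ cyclic → q₂-acyclic (subst (Cyclic g) (path₂-kept ℓ (n≤1+n ℓ)) cyclic)
      where
      q₂-acyclic : ¬ Cyclic g q₂
      q₂-acyclic q₂-cyclic with cyclic-pred f r₂-cyclic
      ... | c , c-cyclic , f-c = path₂-acyclic ℓ ≤-refl (subst (Cyclic f) (sym q₂≡c) c-cyclic)
        where
        c≢x : c ≢ x
        c≢x refl = fx≢r₂ f-c
        q₂≡c : q₂ ≡ c
        q₂≡c = cyclic-injective g q₂-cyclic (kept c c-cyclic)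
                 (trans (agree q₂ (acyclic-≢ (path₂-acyclic ℓ ≤-refl) x-cyclic))
                        (trans f-q₂ (trans (sym f-c) (sym (agree c c≢x)))))

  -- Lemma A. Let a be the cycle predecessor of r₁. Redirecting a to any b ≠ r₁ improves S:
  -- either r₁ leaves the cycles (p₁ sinks below level L), or all cycles survive and b joins one.
  redirect-root-predecessor : ∀ {a} → Cyclic f a → f a ≡ r₁ → ∀ j → δ Γ a j ≢ r₁ →
                              Better f (next Γ (redirect Γ S a j))
  redirect-root-predecessor {a} a-cyclic f-a j b≢r₁ = by-cases (cyclic? g r₁)
    where
    g : Fin n → Fin n
    g = next Γ (redirect Γ S a j)
    agree : AgreeOff f g a
    agree = redirect-agree Γ S a j
    b : Fin n
    b = δ Γ a j

    by-cases : Dec (Cyclic g r₁) → Better f g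
    by-cases (no r₁-acyclic) = better-by-level p₁ max (lev-> g L p₁-deep)
      where
      p₁-deep : ¬ Cyclic g ((g ^ L) p₁)
      p₁-deep c = r₁-acyclic (subst (Cyclic g) (path₁-kept agree a-cyclic L ≤-refl) c)
    by-cases (yes r₁-g-cyclic) =
      better-by-cycles p₂ max (p₂-stays-deep agree a-cyclic kept fa≢r₂)
                          (more-cycles kept b-cyclic b-new)
      where
      fa≢r₂ : f a ≢ r₂
      fa≢r₂ fa≡r₂ = distinct (trans (sym f-a) fa≡r₂)
      -- r₁ reaches every vertex of its cycle along a walk avoiding a until the end
      from-r₁ : ∀ {v} → Reach f r₁ v → Reach g r₁ v
      from-r₁ r with first-hit f r
      ... | x , hit , before = x , trans (agree-^ agree x r₁ (first-hit-avoids-pred f f-a hit before)) hit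
      r₁-reaches-a : Reach f r₁ a
      r₁-reaches-a = cyclic-return f a-cyclic (1 , f-a)
      a-g-cyclic : Cyclic g a
      a-g-cyclic = cyclic-reach g r₁-g-cyclic (from-r₁ r₁-reaches-a)
      b-cyclic : Cyclic g b
      b-cyclic = subst (Cyclic g) (redirect-at Γ S a j) (cyclic-f g a-g-cyclic)
      kept : ∀ v → Cyclic f v → Cyclic g v
      kept v v-cyclic with reach? f v-cyclic a
      ... | no unreached    = unreached-cyclic agree unreached v-cyclic
      ... | yes v-reaches-a =
        cyclic-reach g r₁-g-cyclic (from-r₁ (reach-trans f r₁-reaches-a (cyclic-return f v-cyclic v-reaches-a)))
      b-new : ¬ Cyclic f b
      b-new b-cyclic-f with cyclic-pred f b-cyclic-f
      ... | c , c-cyclic , f-c =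
        c≢a (cyclic-injective g (kept c c-cyclic) a-g-cyclic
               (trans (agree c c≢a) (trans f-c (sym (redirect-at Γ S a j)))))
        where
        c≢a : c ≢ a
        c≢a refl = b≢r₁ (trans (sym f-c) f-a)

  -- Lemma B. If p₁ never reaches y, redirecting an edge of y into p₁ hangs y above p₁:
  -- y gets level L + 1.
  redirect-unreached : ∀ {y i} → δ Γ y i ≡ p₁ → ¬ Reach f p₁ y →
                       Better f (next Γ (redirect Γ S y i))
  redirect-unreached {y} {i} y→p₁ unreached = better-by-level y max (lev-> g L y-deep)
    where
    g : Fin n → Fin n
    g = next Γ (redirect Γ S y i)
    y-deep : ¬ Cyclic g ((g ^ L) y)
    y-deep = subst (λ v → ¬ Cyclic g ((g ^ ℓ) v)) (sym (trans (redirect-at Γ S y i) y→p₁))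
               (unreached-acyclic (redirect-agree Γ S y i) unreached ℓ (path₁-acyclic ℓ ≤-refl))

  -- Lemma C. If y lies on the path from p₁ to r₁, redirecting an edge of y into p₁ closes a new
  -- cycle through p₁ while all old cycles and the path of p₂ stay untouched.
  redirect-own-path : ∀ {y i h} → δ Γ y i ≡ p₁ → (f ^ h) p₁ ≡ y →
                      (∀ j → j < h → (f ^ j) p₁ ≢ y) → h < L →
                      Better f (next Γ (redirect Γ S y i))
  redirect-own-path {y} {i} {h} y→p₁ hit before h<L =
    better-by-cycles p₂ max (lev-> g ℓ q₂-acyclic) (more-cycles kept p₁-cyclic (path₁-acyclic 0 z<s))
    where
    g : Fin n → Fin n
    g = next Γ (redirect Γ S y i)
    agree : AgreeOff f g y
    agree = redirect-agree Γ S y i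
    y-acyclic : ¬ Cyclic f y
    y-acyclic = subst (λ v → ¬ Cyclic f v) hit (path₁-acyclic h h<L)
    -- no cyclic vertex reaches the acyclic vertex y
    kept : ∀ v → Cyclic f v → Cyclic g v
    kept v v-cyclic = unreached-cyclic agree (λ r → y-acyclic (cyclic-reach f v-cyclic r)) v-cyclic
    p₁-cyclic : Cyclic g p₁
    p₁-cyclic = suc h , z<s , (begin
      (g ^ suc h) p₁    ≡⟨ ^-suc g h p₁ ⟩
      g ((g ^ h) p₁)    ≡⟨ cong g (trans (agree-^ agree h p₁ before) hit) ⟩
      g y               ≡⟨ trans (redirect-at Γ S y i) y→p₁ ⟩
      p₁                ∎)
      where open ≡-Reasoning
    -- the walk from p₂ never meets y: before its root it would meet the path of p₁, after it
    -- y would be cyclic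
    p₂-misses-y : ¬ Reach f p₂ y
    p₂-misses-y (m , at-y) with m <? L
    ... | yes m<L = distinct (paths-meet f level₁ level₂ h<L m<L (trans hit (sym at-y)))
    ... | no m≮L  = y-acyclic (subst (Cyclic f) (trans (sym (^-split f p₂ (≮⇒≥ m≮L))) at-y)
                                      (cyclic-^ f (m ∸ L) r₂-cyclic))
    q₂-acyclic : ¬ Cyclic g ((g ^ ℓ) p₂)
    q₂-acyclic = unreached-acyclic agree p₂-misses-y ℓ (path₂-acyclic ℓ ≤-refl)

-- Let y lie on the cycle of r₁ and have an edge i into p₁. Redirecting y into p₁
-- replaces the arc D of that cycle from d = f y up to r₁ (t vertices) by the path P from p₁
-- to r₁ (L vertices), so that  cycleCount g + t ≡ cycleCount f + L.  For t < L the cycles grow,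
-- for t > L the vertex d sinks below level L.  For t = L nothing is lost, d takes over the
-- role of p₁, and q₁, the last vertex of P, is now the cycle predecessor of r₁: if q₁ has an
-- edge avoiding r₁, Lemma A applies to the new subgraph.
module RootCycle {n k : ℕ} (Γ : Graph n k) (S : Spanning Γ) (ℓ : ℕ) {p₁ p₂ : Fin n}
  (max : maxLevel (next Γ S) ≡ suc ℓ)
  (level₁ : Level (next Γ S) p₁ (suc ℓ)) (level₂ : Level (next Γ S) p₂ (suc ℓ))
  (distinct : (next Γ S ^ suc ℓ) p₁ ≢ (next Γ S ^ suc ℓ) p₂)
  {y : Fin n} {i : Fin k} (y→p₁ : δ Γ y i ≡ p₁)
  (r₁-reaches-y : Reach (next Γ S) ((next Γ S ^ suc ℓ) p₁) y)
  where

  open TwoRoots Γ S ℓ max level₁ level₂ distinct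
  open Counting

  y-cyclic : Cyclic f y
  y-cyclic = cyclic-reach f r₁-cyclic r₁-reaches-y

  s : ℕ
  s = proj₁ (first-hit f r₁-reaches-y)
  s-hit : (f ^ s) r₁ ≡ y
  s-hit = proj₁ (proj₂ (first-hit f r₁-reaches-y))
  s-before : ∀ j → j < s → (f ^ j) r₁ ≢ y
  s-before = proj₂ (proj₂ (first-hit f r₁-reaches-y))

  d : Fin n
  d = f y

  r₁-to-d : (f ^ suc s) r₁ ≡ d
  r₁-to-d = trans (^-suc f s r₁) (cong f s-hit)

  d-reaches-r₁ : Reach f d r₁
  d-reaches-r₁ = cyclic-return f r₁-cyclic (suc s , r₁-to-d)

  t : ℕ
  t = proj₁ (first-hit f d-reaches-r₁)
  t-hit : (f ^ t) d ≡ r₁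
  t-hit = proj₁ (proj₂ (first-hit f d-reaches-r₁))
  t-before : ∀ u → u < t → (f ^ u) d ≢ r₁
  t-before = proj₂ (proj₂ (first-hit f d-reaches-r₁))

  g : Fin n → Fin n
  g = next Γ (redirect Γ S y i)

  agree : AgreeOff f g y
  agree = redirect-agree Γ S y i

  g-y : g y ≡ p₁
  g-y = trans (redirect-at Γ S y i) y→p₁

  D : (Fin n → Set)
  D = Image (λ u → (f ^ u) d) t

  P : (Fin n → Set)
  P = Image (λ j → (f ^ j) p₁) L

  arc-kept : ∀ u → u ≤ t → (g ^ u) d ≡ (f ^ u) d
  arc-kept u u≤t =
    agree-^ agree u d λ j j<u → first-hit-avoids-pred f refl t-hit t-before j (<-≤-trans j<u u≤t)

  r₁-arc-kept : ∀ x → x ≤ s → (g ^ x) r₁ ≡ (f ^ x) r₁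
  r₁-arc-kept x x≤s = agree-^ agree x r₁ λ j j<x → s-before j (<-≤-trans j<x x≤s)

  r₁-to-p₁ : (g ^ suc s) r₁ ≡ p₁
  r₁-to-p₁ = trans (^-suc g s r₁) (trans (cong g (trans (r₁-arc-kept s ≤-refl) s-hit)) g-y)

  r₁-g-cyclic : Cyclic g r₁
  r₁-g-cyclic = suc s + L , z<s ,
    trans (^-+ g (suc s) L r₁) (trans (cong (g ^ L) r₁-to-p₁) (path₁-kept agree y-cyclic L ≤-refl))

  P⇒g-cyclic : ∀ v → P v → Cyclic g v
  P⇒g-cyclic v (j , j<L , refl) = cyclic-reach g r₁-g-cyclic
    (suc s + j , trans (^-+ g (suc s) j r₁)
                       (trans (cong (g ^ j) r₁-to-p₁) (path₁-kept agree y-cyclic j (<⇒≤ j<L))))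

  P⇒f-acyclic : ∀ v → P v → ¬ Cyclic f v
  P⇒f-acyclic v (j , j<L , refl) = path₁-acyclic j j<L

  D⇒f-cyclic : ∀ v → D v → Cyclic f v
  D⇒f-cyclic v (u , _ , refl) = cyclic-^ f u (cyclic-f f y-cyclic)

  D⇒reach-y : ∀ v → D v → Reach f v y
  D⇒reach-y v (u , u<t , refl) =
    reach-trans f (t ∸ u , trans (sym (^-split f d (<⇒≤ u<t))) t-hit) (s , s-hit)

  NewCycle : (Fin n → Set)
  NewCycle v = (∃ λ x → x ≤ s × (f ^ x) r₁ ≡ v) ⊎ P v

  new-cycle-closed : ∀ v → NewCycle v → NewCycle (g v)
  new-cycle-closed v (inj₁ (x , x≤s , refl)) with m≤n⇒m<n∨m≡n x≤s
  ... | inj₁ x<s  = inj₁ (suc x , x<s , trans (^-suc f x r₁) (sym (agree _ (s-before x x<s))))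
  ... | inj₂ refl = inj₂ (0 , z<s , sym (trans (cong g s-hit) g-y))
  new-cycle-closed v (inj₂ (j , j<L , refl)) with m≤n⇒m<n∨m≡n j<L
  ... | inj₁ j+1<L = inj₂ (suc j , j+1<L , trans (^-suc f j p₁) (sym (agree _ off-y)))
    where
    off-y : (f ^ j) p₁ ≢ y
    off-y = acyclic-≢ (path₁-acyclic j j<L) y-cyclic
  ... | inj₂ refl  = inj₁ (0 , z≤n , sym (trans (agree _ off-y) (sym (^-suc f ℓ p₁))))
    where
    off-y : (f ^ ℓ) p₁ ≢ y
    off-y = acyclic-≢ (path₁-acyclic ℓ ≤-refl) y-cyclic

  new-cycle-^ : ∀ m v → NewCycle v → NewCycle ((g ^ m) v)
  new-cycle-^ zero    v new = new
  new-cycle-^ (suc m) v new = new-cycle-^ m (g v) (new-cycle-closed v new)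

  new-cycle⇒ : ∀ v → NewCycle v → (Cyclic f v × ¬ D v) ⊎ P v
  new-cycle⇒ v (inj₁ (x , x≤s , at)) = inj₁ (subst (Cyclic f) at (cyclic-^ f x r₁-cyclic) , not-D)
    where
    not-D : ¬ D v
    not-D (u , u<t , at′) = arcs-disjoint f s-hit s-before t-hit t-before x≤s u<t (trans at (sym at′))
  new-cycle⇒ v (inj₂ v∈P) = inj₂ v∈P

  g-cyclic⇒ : ∀ v → Cyclic g v → (Cyclic f v × ¬ D v) ⊎ P v
  g-cyclic⇒ v v-cyclic = by-reach (reach? g v-cyclic y)
    where
    by-reach : Dec (Reach g v y) → (Cyclic f v × ¬ D v) ⊎ P v
    by-reach (no unreached) =
      inj₁ (unreached-cyclic (agree-sym agree) unreached v-cyclic ,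
            λ v∈D → unreached-reach (agree-sym agree) unreached (D⇒reach-y v v∈D))
    by-reach (yes reaches) =
      let (m , back) = cyclic-return g v-cyclic reaches
      in new-cycle⇒ v (subst NewCycle back (new-cycle-^ m y (inj₁ (s , ≤-refl , s-hit))))

  via-d : ∀ {x} → s < x → (f ^ x) r₁ ≡ (f ^ (x ∸ suc s)) d
  via-d {x} s<x = trans (^-split f r₁ s<x) (cong (f ^ (x ∸ suc s)) r₁-to-d)

  -- A vertex first reached from r₁ only after passing y lies in D (after D comes r₁ again).
  past-y⇒D : ∀ {x v} → s < x → (f ^ x) r₁ ≡ v → (∀ j → j < x → (f ^ j) r₁ ≢ v) → D v
  past-y⇒D {x} {v} s<x hit before =
    [ (λ w<t → w , w<t , trans (sym (via-d s<x)) hit) , (λ t≤w → ⊥-elim (around t≤w)) ]′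
      (<-≤-connex w t)
    where
    w : ℕ
    w = x ∸ suc s
    around : t ≤ w → ⊥
    around t≤w = before (w ∸ t) (≤-<-trans (m∸n≤m w t) (∸-monoʳ-< {x} {suc s} {0} z<s s<x)) (begin
      (f ^ (w ∸ t)) r₁                ≡⟨ cong (f ^ (w ∸ t)) (sym t-hit) ⟩
      (f ^ (w ∸ t)) ((f ^ t) d)       ≡⟨ sym (^-split f d t≤w) ⟩
      (f ^ w) d                       ≡⟨ sym (via-d s<x) ⟩
      (f ^ x) r₁                      ≡⟨ hit ⟩
      v                               ∎)
      where open ≡-Reasoning

  reached-from-r₁ : ∀ {v} → Reach f r₁ v → Cyclic g v ⊎ D v
  reached-from-r₁ {v} r =
    let (x , hit , before) = first-hit f r in
    ⊎-map (λ x≤s → cyclic-reach g r₁-g-cyclic (x , trans (r₁-arc-kept x x≤s) hit))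
                 (λ s<x → past-y⇒D s<x hit before) (≤-<-connex x s)

  f-cyclic⇒ : ∀ v → Cyclic f v → ¬ D v → Cyclic g v
  f-cyclic⇒ v v-cyclic not-D = by-reach (reach? f v-cyclic y)
    where
    by-reach : Dec (Reach f v y) → Cyclic g v
    by-reach (no unreached) = unreached-cyclic agree unreached v-cyclic
    by-reach (yes reaches)  = [ id , ⊥-elim ∘ not-D ]′
      (reached-from-r₁ (reach-trans f r₁-reaches-y (cyclic-return f v-cyclic reaches)))

  D? : Decidable D
  D? = image? (λ u → (f ^ u) d) t

  P? : Decidable P
  P? = image? (λ j → (f ^ j) p₁) L

  g-cyclic⇒¬D : ∀ v → Cyclic g v → ¬ D v
  g-cyclic⇒¬D v v-cyclic =
    [ proj₂ , (λ v∈P v∈D → P⇒f-acyclic v v∈P (D⇒f-cyclic v v∈D)) ]′ (g-cyclic⇒ v v-cyclic)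

  -- Cyclic g ∪ D and Cyclic f ∪ P are the same set, and both unions are disjoint.
  count-balance : cycleCount g + t ≡ cycleCount f + L
  count-balance = begin
    cycleCount g + t                 ≡⟨ cong₂ _+_ (cycleCount-count g) (sym (count-image _ t D-injective)) ⟩
    count (cyclic? g) + count D?     ≡⟨ sym (count-∪ (cyclic? g) D? g-cyclic⇒¬D) ⟩
    count (cyclic? g ∪? D?)          ≡⟨ count-cong _ (cyclic? f ∪? P?) old⇒new new⇒old ⟩
    count (cyclic? f ∪? P?)          ≡⟨ count-∪ (cyclic? f) P? (λ v c v∈P → P⇒f-acyclic v v∈P c) ⟩
    count (cyclic? f) + count P?     ≡⟨ cong₂ _+_ (sym (cycleCount-count f)) (count-image _ L P-injective) ⟩
    cycleCount f + L                 ∎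
    where
    open ≡-Reasoning
    D-injective : ∀ u u′ → u < t → u′ < t → (f ^ u) d ≡ (f ^ u′) d → u ≡ u′
    D-injective u u′ = first-hit-injective f t-hit t-before
    P-injective : ∀ j j′ → j < L → j′ < L → (f ^ j) p₁ ≡ (f ^ j′) p₁ → j ≡ j′
    P-injective j j′ = level-path-injective f level₁
    old⇒new : ∀ v → (Cyclic g ∪ D) v → (Cyclic f ∪ P) v
    old⇒new v (inj₁ v-cyclic) = ⊎-map₁ proj₁ (g-cyclic⇒ v v-cyclic)
    old⇒new v (inj₂ v∈D) = inj₁ (D⇒f-cyclic v v∈D)
    new⇒old : ∀ v → (Cyclic f ∪ P) v → (Cyclic g ∪ D) v
    new⇒old v (inj₁ v-cyclic) = kept-or-D (D? v)
      where
      kept-or-D : Dec (D v) → (Cyclic g ∪ D) v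
      kept-or-D (yes v∈D) = inj₂ v∈D
      kept-or-D (no  v∉D) = inj₁ (f-cyclic⇒ v v-cyclic v∉D)
    new⇒old v (inj₂ v∈P) = inj₁ (P⇒g-cyclic v v∈P)

  d-deep : ∀ u → u < t → u < lev g d
  d-deep u u<t = lev-> g u λ c → g-cyclic⇒¬D _ (subst (Cyclic g) (arc-kept u (<⇒≤ u<t)) c) (u , u<t , refl)

  p₂-deep : L ≤ lev g p₂
  p₂-deep = lev-> g ℓ λ c → q₂-acyclic (subst (Cyclic g) (path₂-kept agree y-cyclic ℓ (n≤1+n ℓ)) c)
    where
    q₂-acyclic : ¬ Cyclic g q₂
    q₂-acyclic c = [ (λ (q₂-f-cyclic , _) → path₂-acyclic ℓ ≤-refl q₂-f-cyclic)
                   , (λ (j , j<L , at-q₂) → distinct (paths-meet f level₁ level₂ j<L ≤-refl at-q₂)) ]′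
                   (g-cyclic⇒ q₂ c)

  q₁ : Fin n
  q₁ = (f ^ ℓ) p₁

  q₁-g-cyclic : Cyclic g q₁
  q₁-g-cyclic = P⇒g-cyclic q₁ (ℓ , ≤-refl , refl)

  g-q₁ : g q₁ ≡ r₁
  g-q₁ = trans (agree q₁ (acyclic-≢ (path₁-acyclic ℓ ≤-refl) y-cyclic)) (sym (^-suc f ℓ p₁))

  -- For t = L and unchanged maximal level, g ties with f and has two maximal vertices d and p₂
  -- with the roots r₁ ≠ r₂; redirecting q₁ away from r₁ then improves by Lemma A.
  tie-break : t ≡ L → maxLevel g ≡ L → ∀ j → δ Γ q₁ j ≢ r₁ →
              Better f (next Γ (redirect Γ (redirect Γ S y i) q₁ j))
  tie-break t≡L max-g j q₁↛r₁ =
    better-via-tie {g = g} (trans max-g (sym max)) cycles-equal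
      (TwoRoots.redirect-root-predecessor Γ (redirect Γ S y i) ℓ max-g d-level p₂-level distinct′
         q₁-g-cyclic (trans g-q₁ (sym d-root)) j (λ e → q₁↛r₁ (trans e d-root)))
    where
    cycles-equal : cycleCount g ≡ cycleCount f
    cycles-equal = +-cancelʳ-≡ L (cycleCount g) (cycleCount f)
                     (subst (λ m → cycleCount g + m ≡ cycleCount f + L) t≡L count-balance)
    d-level : Level g d L
    d-level = level-squeezed g (d-deep ℓ (subst (ℓ <_) (sym t≡L) ≤-refl))
                               (subst (lev g d ≤_) max-g (lev-≤-maxLevel g d))
    p₂-level : Level g p₂ L
    p₂-level = level-squeezed g p₂-deep (subst (lev g p₂ ≤_) max-g (lev-≤-maxLevel g p₂))
    d-root : (g ^ L) d ≡ r₁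
    d-root = subst (λ m → (g ^ m) d ≡ r₁) t≡L (trans (arc-kept t ≤-refl) t-hit)
    distinct′ : (g ^ L) d ≢ (g ^ L) p₂
    distinct′ e = distinct (trans (sym d-root) (trans e (path₂-kept agree y-cyclic L ≤-refl)))

  redirect-root-cycle : ∀ {j} → δ Γ q₁ j ≢ r₁ → ∃ λ S′ → Better f (next Γ S′)
  redirect-root-cycle {j} q₁↛r₁ = by-length (<-cmp t L)
    where
    by-length : Tri (t < L) (t ≡ L) (t > L) → ∃ λ S′ → Better f (next Γ S′)
    by-length (tri< t<L _ _) = redirect Γ S y i , better-by-cycles p₂ max p₂-deep cycles-grow
      where
      cycles-grow : cycleCount f < cycleCount g
      cycles-grow = +-cancelʳ-< t (cycleCount f) (cycleCount g)
                      (<-≤-trans (+-monoʳ-< (cycleCount f) t<L) (≤-reflexive (sym count-balance)))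
    by-length (tri> _ _ L<t) = redirect Γ S y i , better-by-level d max (d-deep L L<t)
    by-length (tri≈ _ t≡L _) = tie t≡L (m≤n⇒m<n∨m≡n (≤-trans p₂-deep (lev-≤-maxLevel g p₂)))
      where
      tie : t ≡ L → L < maxLevel g ⊎ L ≡ maxLevel g → ∃ λ S′ → Better f (next Γ S′)
      tie t≡L (inj₁ L<max-g) = redirect Γ S y i , inj₁ (subst (_< maxLevel g) (sym max) L<max-g)
      tie t≡L (inj₂ L≡max-g) = redirect Γ (redirect Γ S y i) q₁ j , tie-break t≡L (sym L≡max-g) j q₁↛r₁

module _ {n k : ℕ} (Γ : Graph n k) where

  incoming-edge : StronglyConnected Γ → Fin k → ∀ p → ∃ λ y → ∃ λ i → δ Γ y i ≡ p
  incoming-edge sc i₀ p =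
    last-edge (δ Γ p i₀) (proj₁ (sc (δ Γ p i₀) p)) (proj₂ (sc (δ Γ p i₀) p)) (p , i₀ , refl)
    where
    -- the last edge of a walk from z to p, given an edge into z in case the walk is empty
    last-edge : ∀ z w → walk Γ z w ≡ p → (∃ λ y → ∃ λ i → δ Γ y i ≡ z) →
                ∃ λ y → ∃ λ i → δ Γ y i ≡ p
    last-edge z []      refl into-z = into-z
    last-edge z (j ∷ w) ends into-z = last-edge (δ Γ z j) w ends (z , j , refl)

  edge-avoiding : NoTwoIncomingBunches Γ → ∀ {a q r} → BunchTo Γ a r → q ≢ a →
                  ∃ λ j → δ Γ q j ≢ r
  edge-avoiding noTwo {a} {q} {r} bunch q≢a =
    ¬∀⟶∃¬ k _ (λ j → δ Γ q j ≟ᶠ r) λ q-bunch → noTwo q a r q≢a q-bunch bunch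

  -- Let a be the cycle predecessor of r₁ and y → p₁ an edge into p₁. If a is not a bunch, Lemma A
  -- applies; otherwise Lemma C, D or B applies according to where y lies: on the path from p₁,
  -- on the cycle of r₁ (q₁ ≠ a is then not a bunch into r₁), or out of reach of p₁.
  improve : StronglyConnected Γ → NoTwoIncomingBunches Γ → Fin k →
            ∀ S ℓ {p₁ p₂} → maxLevel (next Γ S) ≡ suc ℓ →
            Level (next Γ S) p₁ (suc ℓ) → Level (next Γ S) p₂ (suc ℓ) →
            (next Γ S ^ suc ℓ) p₁ ≢ (next Γ S ^ suc ℓ) p₂ →
            ∃ λ S′ → Better (next Γ S) (next Γ S′)
  improve sc noTwo i₀ S ℓ {p₁} max level₁ level₂ distinct = by-bunch (all? λ j → δ Γ a j ≟ᶠ r₁)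
    where
    open TwoRoots Γ S ℓ max level₁ level₂ distinct
    a : Fin n
    a = proj₁ (cyclic-pred f r₁-cyclic)
    a-cyclic : Cyclic f a
    a-cyclic = proj₁ (proj₂ (cyclic-pred f r₁-cyclic))
    f-a : f a ≡ r₁
    f-a = proj₂ (proj₂ (cyclic-pred f r₁-cyclic))
    y : Fin n
    y = proj₁ (incoming-edge sc i₀ p₁)
    i : Fin k
    i = proj₁ (proj₂ (incoming-edge sc i₀ p₁))
    y→p₁ : δ Γ y i ≡ p₁
    y→p₁ = proj₂ (proj₂ (incoming-edge sc i₀ p₁))

    by-position : BunchTo Γ a r₁ → Dec (∃ λ h → h < L × (f ^ h) p₁ ≡ y) → Dec (Reach f r₁ y) →
                  ∃ λ S′ → Better f (next Γ S′)
    by-position _ (yes (h , h<L , hit)) _ =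
      let (h′ , hit′ , before) = first-hit f (h , hit)
          h′≤h = ≮⇒≥ λ h<h′ → before h h<h′ hit
      in redirect Γ S y i , redirect-own-path y→p₁ hit′ before (≤-<-trans h′≤h h<L)
    by-position bunch (no _) (yes on-cycle) =
      RootCycle.redirect-root-cycle Γ S ℓ max level₁ level₂ distinct y→p₁ on-cycle
        (proj₂ (edge-avoiding noTwo bunch (acyclic-≢ (path₁-acyclic ℓ ≤-refl) a-cyclic)))
    by-position _ (no off-path) (no off-cycle) = redirect Γ S y i , redirect-unreached y→p₁ unreached
      where
      unreached : ¬ Reach f p₁ y
      unreached (m , hit) = [ (λ m<L → off-path (m , m<L , hit))
                            , (λ L≤m → off-cycle (m ∸ L , trans (sym (^-split f p₁ L≤m)) hit)) ]′
                            (<-≤-connex m L)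

    by-bunch : Dec (BunchTo Γ a r₁) → ∃ λ S′ → Better f (next Γ S′)
    by-bunch (yes bunch)    =
      by-position bunch (anyUpTo? (λ h → (f ^ h) p₁ ≟ᶠ y) L) (reach? f r₁-cyclic y)
    by-bunch (no not-bunch) =
      let (j , a↛r₁) = ¬∀⟶∃¬ k _ (λ j → δ Γ a j ≟ᶠ r₁) not-bunch
      in redirect Γ S a j , redirect-root-predecessor a-cyclic f-a j a↛r₁

  -- An AGW graph has a vertex: without vertices there are no cycles, and the gcd condition fails.
  a-vertex : CycleGcdOne Γ → Fin n
  a-vertex gcd with any? {P = λ (_ : Fin n) → ⊤} (λ _ → yes tt)
  ... | yes (v , _) = v
  ... | no none with gcd 0 (λ C → ⊥-elim (none (start C , tt)))
  ...   | ()

  -- If every vertex is the source of a bunch (and no two bunches share their target), then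
  -- the graph is a permutation whose cycles are the cycles of Γ; the least period c of any
  -- vertex divides all cycle lengths, so c = 1 by the gcd condition: Γ has a loop.
  bunches⇒loop : AGW Γ → NoTwoIncomingBunches Γ → (i₀ : Fin k) →
                 (∀ v i → δ Γ v i ≡ δ Γ v i₀) → ∃ λ v → δ Γ v i₀ ≡ v
  bunches⇒loop (sc , gcd) noTwo i₀ bunch = s , loop
    where
    f : Fin n → Fin n
    f v = δ Γ v i₀
    f-injective : ∀ u w → f u ≡ f w → u ≡ w
    f-injective u w fu≡fw = decidable-stable (u ≟ᶠ w) λ u≢w →
      noTwo u w (f u) u≢w (λ i → bunch u i) (λ i → trans (bunch w i) (sym fu≡fw))
    ^-injective : ∀ m u w → (f ^ m) u ≡ (f ^ m) w → u ≡ w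
    ^-injective zero    u w eq = eq
    ^-injective (suc m) u w eq = f-injective u w (^-injective m (f u) (f w) eq)
    walk-is-^ : ∀ z w → walk Γ z w ≡ (f ^ length w) z
    walk-is-^ z []      = refl
    walk-is-^ z (i ∷ w) = trans (cong (λ v → walk Γ v w) (bunch z i)) (walk-is-^ (f z) w)
    s : Fin n
    s = a-vertex gcd
    -- s is cyclic: (f ^ n) s is, and f ^ n is injective
    s-period : ∃ λ m → (f ^ suc m) s ≡ s
    s-period with cyclic-^n f s
    ... | suc m , _ , fix = m , ^-injective n _ _ (trans (^-comm f n (suc m) s) fix)
    least-period : ∃ λ c → c ≤ proj₁ s-period × (f ^ suc c) s ≡ s ×
                           (∀ i → i < c → (f ^ suc i) s ≢ s)
    least-period = least (λ m → (f ^ suc m) s ≟ᶠ s) {proj₁ s-period} (proj₂ s-period)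
    c : ℕ
    c = proj₁ least-period
    c-period : (f ^ suc c) s ≡ s
    c-period = proj₁ (proj₂ (proj₂ least-period))
    c-least : ∀ i → i < c → (f ^ suc i) s ≢ s
    c-least = proj₂ (proj₂ (proj₂ least-period))
    -- every cycle of Γ, started at z, brings s back to itself as well
    divides-cycles : ∀ C → suc c ∣ length (edges C)
    divides-cycles C = minimal-period-divides f c-period c-least len s-fix
      where
      len : ℕ
      len = length (edges C)
      to-z : ∃ λ w → walk Γ s w ≡ start C
      to-z = sc s (start C)
      a : ℕ
      a = length (proj₁ to-z)
      s-to-z : (f ^ a) s ≡ start C
      s-to-z = trans (sym (walk-is-^ s (proj₁ to-z))) (proj₂ to-z)
      s-fix : (f ^ len) s ≡ s
      s-fix = ^-injective a _ _ (begin
        (f ^ a) ((f ^ len) s)    ≡⟨ ^-comm f a len s ⟩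
        (f ^ len) ((f ^ a) s)    ≡⟨ cong (f ^ len) s-to-z ⟩
        (f ^ len) (start C)      ≡⟨ sym (walk-is-^ (start C) (edges C)) ⟩
        walk Γ (start C) (edges C) ≡⟨ closed C ⟩
        start C                  ≡⟨ sym s-to-z ⟩
        (f ^ a) s                ∎)
        where open ≡-Reasoning
    loop : f s ≡ s
    loop = subst (λ m → (f ^ suc m) s ≡ s) (suc-injective (gcd (suc c) divides-cycles)) c-period

  acyclic⇒positive : ∀ S {w} → ¬ Cyclic (next Γ S) w → 0 < maxLevel (next Γ S)
  acyclic⇒positive S {w} acyclic = <-≤-trans (lev-> (next Γ S) 0 acyclic) (lev-≤-maxLevel (next Γ S) w)

  -- Some spanning subgraph has positive maximal level: the constant choice i₀, unless all its
  -- vertices are cyclic; then redirect a vertex that is not a bunch (Lemma bunches⇒loop).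
  positive-start : AGW Γ → NoLoops Γ → NoTwoIncomingBunches Γ → Fin k →
                   ∃ λ S → 0 < maxLevel (next Γ S)
  positive-start agw no-loops noTwo i₀ = by-cycles (all? (cyclic? (next Γ S₀)))
    where
    S₀ : Spanning Γ
    S₀ _ = i₀
    not-bunch : ∃ λ v → ∃ λ i → δ Γ v i ≢ δ Γ v i₀
    not-bunch =
      let (v , ¬v-bunch) = ¬∀⟶∃¬ n _ (λ v → all? λ i → δ Γ v i ≟ᶠ δ Γ v i₀)
                             λ bunch → let (v , loop) = bunches⇒loop agw noTwo i₀ bunch in no-loops v i₀ loop
          (i , i-off) = ¬∀⟶∃¬ k _ (λ i → δ Γ v i ≟ᶠ δ Γ v i₀) ¬v-bunch
      in v , i , i-off
    v : Fin n
    v = proj₁ not-bunch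
    i : Fin k
    i = proj₁ (proj₂ not-bunch)
    S₁ : Spanning Γ
    S₁ = redirect Γ S₀ v i
    by-cycles : Dec (∀ w → Cyclic (next Γ S₀) w) → ∃ λ S → 0 < maxLevel (next Γ S)
    by-cycles (no some-acyclic) =
      S₀ , acyclic⇒positive S₀ (proj₂ (¬∀⟶∃¬ n _ (cyclic? (next Γ S₀)) some-acyclic))
    by-cycles (yes all-cyclic)  = S₁ , acyclic⇒positive S₁ (proj₂ (¬∀⟶∃¬ n _ (cyclic? (next Γ S₁))
      (redirect-permutation (redirect-agree Γ S₀ v i) all-cyclic
         λ moved → proj₂ (proj₂ not-bunch) (trans (sym (redirect-at Γ S₀ v i)) moved))))

  Settled : Spanning Γ → Set
  Settled S = 0 < maxLevel (next Γ S) × OneRoot (next Γ S) (maxLevel (next Γ S))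

  settle : StronglyConnected Γ → NoTwoIncomingBunches Γ → Fin k →
           ∀ S → 0 < maxLevel (next Γ S) → ∃ Settled
  settle sc noTwo i₀ = ascend (rank ∘ next Γ) (n * suc n + n) (rank-≤ ∘ next Γ) Positive Settled step
    where
    Positive : Spanning Γ → Set
    Positive S = 0 < maxLevel (next Γ S)
    step : ∀ S → Positive S →
           Settled S ⊎ ∃ λ S′ → rank (next Γ S) < rank (next Γ S′) × Positive S′
    step S positive =
      [ (λ one → inj₁ (positive , one)) , (λ two → inj₂ (lift (two-roots _ refl positive two))) ]′
      (one-root-or-two f (maxLevel f))
      where
      f : Fin n → Fin n
      f = next Γ S
      two-roots : ∀ L → maxLevel f ≡ L → 0 < L →
                  (∃ λ p → ∃ λ q → Level f p L × Level f q L × (f ^ L) p ≢ (f ^ L) q) →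
                  ∃ λ S′ → Better f (next Γ S′)
      two-roots (suc ℓ) max _ (p , q , level-p , level-q , split) =
        improve sc noTwo i₀ S ℓ max level-p level-q split
      lift : (∃ λ S′ → Better f (next Γ S′)) →
             ∃ λ S′ → rank f < rank (next Γ S′) × Positive S′
      lift (S′ , better) = S′ , better⇒rank-< better , <-≤-trans positive (better⇒maxLevel-≤ better)

  next^-^ : ∀ S m p → next^ Γ S m p ≡ (next Γ S ^ m) p
  next^-^ S zero    p = refl
  next^-^ S (suc m) p = next^-^ S m (next Γ S p)

  onCycle⇔cyclic : ∀ S {p} → (OnCycle Γ S p → Cyclic (next Γ S) p) ×
                              (Cyclic (next Γ S) p → OnCycle Γ S p)
  onCycle⇔cyclic S {p} = (λ (m , 0<m , fix) → m , 0<m , trans (sym (next^-^ S m p)) fix)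
                       , (λ (m , 0<m , fix) → m , 0<m , trans (next^-^ S m p) fix)

  levelIs⇒level : ∀ S {p j} → LevelIs Γ S p j → Level (next Γ S) p j
  levelIs⇒level S {p} {j} (root , before) =
    subst (Cyclic (next Γ S)) (next^-^ S j p) (proj₁ (onCycle⇔cyclic S) root) ,
    λ i i<j c → before i i<j (proj₂ (onCycle⇔cyclic S) (subst (Cyclic (next Γ S)) (sym (next^-^ S i p)) c))

  level⇒levelIs : ∀ S {p j} → Level (next Γ S) p j → LevelIs Γ S p j
  level⇒levelIs S {p} {j} (root , before) =
    proj₂ (onCycle⇔cyclic S) (subst (Cyclic (next Γ S)) (sym (next^-^ S j p)) root) ,
    λ i i<j c → before i i<j (subst (Cyclic (next Γ S)) (next^-^ S i p) (proj₁ (onCycle⇔cyclic S) c))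

  settled⇒claim : ∀ S → Settled S → ∃ λ (L : ℕ) →
      0 < L
      × (∃ λ (p : Fin n) → LevelIs Γ S p L)
      × (∀ (p : Fin n) (j : ℕ) → LevelIs Γ S p j → j ≤ L)
      × (∀ (p q : Fin n) → LevelIs Γ S p L → LevelIs Γ S q L → root Γ S p L ≡ root Γ S q L)
  settled⇒claim S (positive , one-root) =
    maxLevel f , positive ,
    (p , level⇒levelIs S (subst (Level f p) lev-p (lev-level f p))) ,
    (λ q j level-q → subst (_≤ maxLevel f) (sym (level-unique f (levelIs⇒level S level-q)))
                           (lev-≤-maxLevel f q)) ,
    λ q q′ level-q level-q′ →
      trans (next^-^ S (maxLevel f) q)
            (trans (one-root q q′ (levelIs⇒level S level-q) (levelIs⇒level S level-q′))
                   (sym (next^-^ S (maxLevel f) q′)))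
    where
    f : Fin n → Fin n
    f = next Γ S
    p : Fin n
    p = proj₁ (maxLevel-attained f positive)
    lev-p : lev f p ≡ maxLevel f
    lev-p = proj₂ (maxLevel-attained f positive)

lemma7 : ∀ {n k : ℕ} (Γ : Graph n k) → AGW Γ → NoLoops Γ → 2 ≤ k →
    NoTwoIncomingBunches Γ →
    ∃ λ (S : Spanning Γ) → ∃ λ (L : ℕ) →
      0 < L
      × (∃ λ (p : Fin n) → LevelIs Γ S p L)
      × (∀ (p : Fin n) (j : ℕ) → LevelIs Γ S p j → j ≤ L)
      × (∀ (p q : Fin n) → LevelIs Γ S p L → LevelIs Γ S q L →
           root Γ S p L ≡ root Γ S q L)
lemma7 Γ agw@(sc , _) no-loops 2≤k noTwo =
  let i₀                 = fromℕ< (≤-trans (s≤s z≤n) 2≤k)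
      (S₀ , positive)    = positive-start Γ agw no-loops noTwo i₀
      (S , settled)      = settle Γ sc noTwo i₀ S₀ positive
  in S , settled⇒claim Γ S settled
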